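{- Let $G=(V,E)$ be a simple digraph. Then $G$ is a circular-arc catch digraph if and only if there exists an ordering $v_1,\dots,v_n$ of $V$ such that, when both the rows and the columns of the augmented adjacency matrix $A^{*}(G)$ are arranged in this order, $A^{*}(G)$ has the circular ones property along rows, i.e. in every row either the ones or the zeros occur in circularly consecutive positions.
   Context: A simple digraph $G=(V,E)$ is a circular-arc catch digraph if to each $v\in V$ one can associate a circular arc $I_v$ on a circle and a point $p_v\in I_v$ such that for distinct $u,v\in V$, $uv\in E$ if and only if $p_v\in I_u$. The augmented adjacency matrix $A^{*}(G)$ is the adjacency matrix of $G$ with all diagonal entries replaced by $1$. Positions $1,\dots,n$ are regarded circularly (position $n$ is followed by position $1$).
   Formalization: The circle is taken as the rationals in [0,1) with 0 and 1 identified, so the arcs $I_v$ have rational endpoints and the points $p_v$ are rational. -}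

module Defs where

open import Data.Nat as ℕ using (ℕ; _∸_; _≤ᵇ_)
import Data.Nat as N
open import Data.Fin using (Fin; toℕ)
open import Data.Fin.Permutation using (Permutation′; _⟨$⟩ʳ_)
open import Data.Bool using (Bool; true; false; if_then_else_; not)
open import Data.Rational as Q using (ℚ; 0ℚ; 1ℚ)
open import Data.Product using (Σ; _×_; ∃; ∃-syntax; _,_)
open import Data.Sum using (_⊎_)
open import Relation.Binary.PropositionalEquality using (_≡_; _≢_)
open import Relation.Nullary using (¬_)
open import Relation.Nullary.Decidable using (⌊_⌋)
open import Function.Bundles using (_⇔_)

record SimpleDigraph (n : ℕ) : Set where
  field
    arc     : Fin n → Fin n → Bool
    loopless : ∀ v → arc v v ≡ false
open SimpleDigraph public

-- The circle is modelled as the half-open interval [0,1) of rationals,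
-- with 1 identified with 0.
OnCircle : ℚ → Set
OnCircle x = (0ℚ Q.≤ x) × (x Q.< 1ℚ)

-- A (closed) circular arc, traversed counterclockwise from `start` to `end`.
record Arc : Set where
  constructor arcFromTo
  field
    start : ℚ
    end   : ℚ
open Arc public

_∈Arc_ : ℚ → Arc → Set
x ∈Arc arcFromTo a b =
  ((a Q.≤ b) × (a Q.≤ x) × (x Q.≤ b))
  ⊎ ((b Q.< a) × ((a Q.≤ x) ⊎ (x Q.≤ b)))

IsCircularArcCatchDigraph : ∀ {n} → SimpleDigraph n → Set
IsCircularArcCatchDigraph {n} G =
  Σ (Fin n → Arc) λ I → Σ (Fin n → ℚ) λ p →
    (∀ v → OnCircle (start (I v)) × OnCircle (end (I v)) × OnCircle (p v))
    × (∀ v → p v ∈Arc I v)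
    × (∀ u v → u ≢ v → ((arc G u v ≡ true) ⇔ (p v ∈Arc I u)))

augAdj : ∀ {n} → SimpleDigraph n → Fin n → Fin n → Bool
augAdj G u v = if ⌊ u Data.Fin.≟ v ⌋ then true else arc G u v

offset : (n : ℕ) → Fin n → Fin n → ℕ
offset n s j = if toℕ s ≤ᵇ toℕ j then toℕ j ∸ toℕ s else (toℕ j N.+ n) ∸ toℕ s

CircConsecutive : ∀ {n} → Bool → (Fin n → Bool) → Set
CircConsecutive {n} b r =
  ∃[ s ] ∃[ k ] (k N.≤ n) × (∀ j → (r j ≡ b) ⇔ (offset n s j N.< k))

RowCircularOnes : ∀ {n} → (Fin n → Bool) → Set
RowCircularOnes r = CircConsecutive true r ⊎ CircConsecutive false r

HasCircularOnesForOrdering : ∀ {n} → SimpleDigraph n → Permutation′ n → Set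
HasCircularOnesForOrdering G σ =
  ∀ i → RowCircularOnes (λ j → augAdj G (σ ⟨$⟩ʳ i) (σ ⟨$⟩ʳ j))

-- (⇒) Sort the vertices by their points p_v, cutting the circle open at 0. An arc [a, b]
-- with a ≤ b then catches an interval of this order, and an arc wrapping past 0 catches
-- the complement of one; as p_v ∈ I_v accounts for the diagonal of A*, every row has its
-- ones or its zeros circularly consecutive.
-- (⇐) Put the i-th vertex of the ordering at (2i+1)/(2n+1). Read linearly, the ones of a
-- row form an interval of positions or the complement of one, and such a set is caught by
-- an arc whose ends lie at the even points 2x/(2n+1).

module Submission where

open import Defs
open import Data.Nat using (ℕ)
open import Data.Nat using (zero; suc; _+_; _∸_; _≤_; _<_; _≤ᵇ_; z≤n; s≤s; s≤s⁻¹; _≤?_; _<?_)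
open import Data.Fin.Permutation using (Permutation′)
open import Data.Product using (∃-syntax)
open import Function.Bundles using (_⇔_)

open import Data.Bool using (Bool; true; false; not)
open import Data.Bool.Properties using (not-¬; ¬-not; not-involutive; T-≡)
open import Data.Fin as Fin using (Fin; toℕ; fromℕ<; punchOut)
open import Data.Fin.Properties as FinP
  using (toℕ<n; toℕ-fromℕ<; any?; injective⇒≤; punchOut-injective)
open import Data.Fin.Permutation using (_⟨$⟩ʳ_; _⟨$⟩ˡ_; inverseˡ; inverseʳ; flip)
open import Data.Fin.Subset using (Subset; _∈_; _∉_; ⊤; ∣_∣)
open import Data.Fin.Subset.Properties using (p⊂q⇒∣p∣<∣q∣; ∣⊤∣≡n; ∈⊤)
open import Data.Integer as ℤ using (+_; +≤+; +<+)
import Data.Integer.Properties as ℤP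
open import Data.Nat.Properties
open import Data.Product using (_×_; ∃; _,_; proj₂)
open import Data.Product.Function.NonDependent.Propositional using (_×-⇔_)
open import Data.Rational as ℚ using (ℚ; fromℚᵘ)
import Data.Rational.Properties as ℚP
open import Data.Rational.Unnormalised as ℚᵘ using (mkℚᵘ; *≤*; *<*)
import Data.Rational.Unnormalised.Properties as ℚᵘP
open import Data.Sum using (_⊎_; inj₁; inj₂)
open import Data.Sum.Function.Propositional using (_⊎-⇔_)
open import Data.Vec using (tabulate)
open import Data.Vec.Properties using (lookup∘tabulate; []=⇒lookup; lookup⇒[]=)
open import Function using (_∘_)
open import Function.Bundles using (mk⇔; module Equivalence; mk⤖)
open import Function.Construct.Composition using (_⇔-∘_)
open import Function.Construct.Symmetry using (⇔-sym)
open import Function.Definitions using (Injective; Surjective)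
open import Function.Properties.Bijection using (⤖⇒↔)
open import Function.Related.TypeIsomorphisms using (¬-cong-⇔)
open import Relation.Binary.Bundles using (StrictTotalOrder)
open import Relation.Binary.Definitions using (tri<; tri≈; tri>)
import Relation.Binary.Construct.On as On
open import Data.Product.Relation.Binary.Lex.Strict using (×-strictTotalOrder)
open import Relation.Binary.PropositionalEquality
open import Relation.Nullary using (¬_; Dec; yes; no; contradiction)
open import Relation.Nullary.Decidable using (_×-dec_; decidable-stable; ⌊_⌋; toWitness; fromWitness)
open import Relation.Nullary.Reflects using (ofʸ; ofⁿ)
open import Relation.Unary using (Decidable)

open Equivalence using (to; from)

private
  variable
    n : ℕ

≥⇔≮ : ∀ {m k} → (k ≤ m) ⇔ (¬ m < k)
≥⇔≮ = mk⇔ (λ k≤m m<k → <⇒≱ m<k k≤m) ≮⇒≥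

≡⇔≢not : ∀ b c → (b ≡ c) ⇔ (¬ b ≡ not c)
≡⇔≢not b c = mk⇔ not-¬ (λ b≢¬c → trans (¬-not b≢¬c) (not-involutive c))

∸<⇔<+ : ∀ {m k} o → k ≤ m → (m ∸ k < o) ⇔ (m < k + o)
∸<⇔<+ {m} {k} o k≤m = mk⇔
  (λ lt → subst (_< k + o) k+[m∸k]≡m (+-monoʳ-< k lt))
  (λ lt → +-cancelˡ-< k _ _ (subst (_< k + o) (sym k+[m∸k]≡m) lt))
  where
  k+[m∸k]≡m : k + (m ∸ k) ≡ m
  k+[m∸k]≡m = m+[n∸m]≡n k≤m

<∸⇔+< : ∀ m {k o} → k ≤ o → (m < o ∸ k) ⇔ (m + k < o)
<∸⇔+< m k≤o = mk⇔ (m≤o∸n⇒m+n≤o (suc m) k≤o) (m+n≤o⇒m≤o∸n (suc m))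

Interval : ℕ → ℕ → ℕ → Set
Interval lo hi j = lo ≤ j × j < hi

Interval? : ∀ lo hi j → Dec (Interval lo hi j)
Interval? lo hi j = (lo ≤? j) ×-dec (j <? hi)

¬Interval⇔ : ∀ {lo hi j} → (¬ Interval lo hi j) ⇔ (hi ≤ j ⊎ j < lo)
¬Interval⇔ {lo} {hi} {j} = mk⇔ outside λ
  { (inj₁ hi≤j) (_ , j<hi) → <⇒≱ j<hi hi≤j
  ; (inj₂ j<lo) (lo≤j , _) → <⇒≱ j<lo lo≤j }
  where
  outside : ¬ Interval lo hi j → hi ≤ j ⊎ j < lo
  outside ∉I with lo ≤? j
  ... | yes lo≤j = inj₁ (≮⇒≥ (λ j<hi → ∉I (lo≤j , j<hi)))
  ... | no lo≰j  = inj₂ (≰⇒> lo≰j)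

¬¬Interval⇔ : ∀ {lo hi j} → (¬ ¬ Interval lo hi j) ⇔ Interval lo hi j
¬¬Interval⇔ {lo} {hi} {j} = mk⇔ (decidable-stable (Interval? lo hi j)) (λ i ∉I → ∉I i)

-- Read linearly, a circularly consecutive set of positions is an interval [lo, hi) or
-- the complement of one.
data CircularInterval {p} (X : Fin n → Set p) : Set p where
  interval   : ∀ {lo hi} → lo ≤ hi → hi ≤ n →
               (∀ j → X j ⇔ Interval lo hi (toℕ j)) → CircularInterval X
  coInterval : ∀ {lo hi} → lo ≤ hi → hi ≤ n →
               (∀ j → X j ⇔ (¬ Interval lo hi (toℕ j))) → CircularInterval X

circularInterval-resp : ∀ {p q} {X : Fin n → Set p} {Y : Fin n → Set q} →
  (∀ j → X j ⇔ Y j) → CircularInterval Y → CircularInterval X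
circularInterval-resp X⇔Y (interval lo≤hi hi≤n h)   = interval lo≤hi hi≤n (λ j → h j ⇔-∘ X⇔Y j)
circularInterval-resp X⇔Y (coInterval lo≤hi hi≤n h) = coInterval lo≤hi hi≤n (λ j → h j ⇔-∘ X⇔Y j)

circularInterval-complement : ∀ {p q} {X : Fin n → Set p} {Y : Fin n → Set q} →
  (∀ j → Y j ⇔ (¬ X j)) → CircularInterval X → CircularInterval Y
circularInterval-complement Y⇔¬X (interval lo≤hi hi≤n h) =
  coInterval lo≤hi hi≤n (λ j → ¬-cong-⇔ (h j) ⇔-∘ Y⇔¬X j)
circularInterval-complement Y⇔¬X (coInterval lo≤hi hi≤n h) =
  interval lo≤hi hi≤n (λ j → ¬¬Interval⇔ ⇔-∘ (¬-cong-⇔ (h j) ⇔-∘ Y⇔¬X j))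

offset-cases : ∀ n (s j : Fin n) →
  (toℕ s ≤ toℕ j × offset n s j ≡ toℕ j ∸ toℕ s) ⊎
  (toℕ j < toℕ s × offset n s j ≡ toℕ j + n ∸ toℕ s)
offset-cases n s j with toℕ s ≤ᵇ toℕ j | ≤ᵇ-reflects-≤ (toℕ s) (toℕ j)
... | true  | ofʸ s≤j = inj₁ (s≤j , refl)
... | false | ofⁿ s≰j = inj₂ (≰⇒> s≰j , refl)

window-interval : ∀ (s j : Fin n) {k} → toℕ s + k ≤ n →
  (offset n s j < k) ⇔ Interval (toℕ s) (toℕ s + k) (toℕ j)
window-interval {n} s j {k} s+k≤n with offset-cases n s j
... | inj₁ (s≤j , eq) rewrite eq =
  mk⇔ (λ lt → s≤j , to (∸<⇔<+ k s≤j) lt) (from (∸<⇔<+ k s≤j) ∘ proj₂)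
... | inj₂ (j<s , eq) rewrite eq =
  mk⇔ (λ lt → contradiction (to (∸<⇔<+ k s≤j+n) lt) (≤⇒≯ (≤-trans s+k≤n (m≤n+m n (toℕ j)))))
      (λ (s≤j , _) → contradiction j<s (≤⇒≯ s≤j))
  where
  s≤j+n : toℕ s ≤ toℕ j + n
  s≤j+n = ≤-trans (<⇒≤ (toℕ<n s)) (m≤n+m n (toℕ j))

window-coInterval : ∀ (s j : Fin n) {k} → n ≤ toℕ s + k →
  (offset n s j < k) ⇔ (¬ Interval (toℕ s + k ∸ n) (toℕ s) (toℕ j))
window-coInterval {n} s j {k} n≤s+k with offset-cases n s j
... | inj₁ (s≤j , eq) rewrite eq =
  mk⇔ (λ _ (_ , j<s) → <⇒≱ j<s s≤j)
      (λ _ → from (∸<⇔<+ k s≤j) (<-≤-trans (toℕ<n j) n≤s+k))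
... | inj₂ (j<s , eq) rewrite eq =
  mk⇔ (λ lt (lo≤j , _) → <⇒≱ (from (<∸⇔+< (toℕ j) n≤s+k) (to (∸<⇔<+ k s≤j+n) lt)) lo≤j)
      (λ ∉I → from (∸<⇔<+ k s≤j+n) (to (<∸⇔+< (toℕ j) n≤s+k) (≰⇒> (λ lo≤j → ∉I (lo≤j , j<s)))))
  where
  s≤j+n : toℕ s ≤ toℕ j + n
  s≤j+n = ≤-trans (<⇒≤ (toℕ<n s)) (m≤n+m n (toℕ j))

circConsecutive⇒circularInterval : ∀ {b} {r : Fin n → Bool} →
  CircConsecutive b r → CircularInterval (λ j → r j ≡ b)
circConsecutive⇒circularInterval {n} (s , k , k≤n , h) with toℕ s + k ≤? n
... | yes s+k≤n = interval (m≤m+n (toℕ s) k) s+k≤n (λ j → window-interval s j s+k≤n ⇔-∘ h j)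
... | no s+k≰n = coInterval lo≤s (<⇒≤ (toℕ<n s)) (λ j → window-coInterval s j n≤s+k ⇔-∘ h j)
  where
  n≤s+k : n ≤ toℕ s + k
  n≤s+k = <⇒≤ (≰⇒> s+k≰n)
  lo≤s : toℕ s + k ∸ n ≤ toℕ s
  lo≤s = m≤n+o⇒m∸n≤o (toℕ s + k) n (subst (toℕ s + k ≤_) (+-comm (toℕ s) n) (+-monoʳ-≤ (toℕ s) k≤n))

-- The position i only serves as the start of a window when the interval is empty.
interval⇒circConsecutive : ∀ {b} {r : Fin n → Bool} {lo hi} → Fin n → hi ≤ n →
  (∀ j → (r j ≡ b) ⇔ Interval lo hi (toℕ j)) → CircConsecutive b r
interval⇒circConsecutive {n} {lo = lo} {hi} i hi≤n h with lo <? hi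
... | yes lo<hi = s , hi ∸ lo , ≤-trans (m∸n≤m hi lo) hi≤n , λ j → ⇔-sym (window j) ⇔-∘ h j
  where
  lo<n : lo < n
  lo<n = <-≤-trans lo<hi hi≤n
  s : Fin n
  s = fromℕ< lo<n
  s≡lo : toℕ s ≡ lo
  s≡lo = toℕ-fromℕ< lo<n
  s+k≡hi : toℕ s + (hi ∸ lo) ≡ hi
  s+k≡hi = trans (cong (_+ (hi ∸ lo)) s≡lo) (m+[n∸m]≡n (<⇒≤ lo<hi))
  window : ∀ j → (offset n s j < hi ∸ lo) ⇔ Interval lo hi (toℕ j)
  window j = subst₂ (λ a b → (offset n s j < hi ∸ lo) ⇔ Interval a b (toℕ j)) s≡lo s+k≡hi
    (window-interval s j (subst (_≤ n) (sym s+k≡hi) hi≤n))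
... | no lo≮hi = i , 0 , z≤n , λ j →
  mk⇔ (λ rj≡b → let (lo≤j , j<hi) = to (h j) rj≡b in contradiction (≤-<-trans lo≤j j<hi) lo≮hi) λ ()

rowCircularOnes⇒circularInterval : ∀ {r : Fin n → Bool} →
  RowCircularOnes r → CircularInterval (λ j → r j ≡ true)
rowCircularOnes⇒circularInterval (inj₁ ones)  = circConsecutive⇒circularInterval ones
rowCircularOnes⇒circularInterval {r = r} (inj₂ zeros) =
  circularInterval-complement (λ j → ≡⇔≢not (r j) true) (circConsecutive⇒circularInterval zeros)

circularInterval⇒rowCircularOnes : ∀ {r : Fin n → Bool} → Fin n →
  CircularInterval (λ j → r j ≡ true) → RowCircularOnes r
circularInterval⇒rowCircularOnes i (interval _ hi≤n h) = inj₁ (interval⇒circConsecutive i hi≤n h)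
circularInterval⇒rowCircularOnes {r = r} i (coInterval _ hi≤n h) =
  inj₂ (interval⇒circConsecutive i hi≤n (λ j → ¬¬Interval⇔ ⇔-∘ (¬-cong-⇔ (h j) ⇔-∘ ≡⇔≢not (r j) false)))

ℚ<⇒≱ : ∀ {x y} → x ℚ.< y → ¬ y ℚ.≤ x
ℚ<⇒≱ x<y y≤x = ℚP.<-irrefl refl (ℚP.<-≤-trans x<y y≤x)

ℚ≥⇔≮ : ∀ {x y} → (y ℚ.≤ x) ⇔ (¬ x ℚ.< y)
ℚ≥⇔≮ = mk⇔ (λ y≤x x<y → ℚ<⇒≱ x<y y≤x) ℚP.≮⇒≥

∈Arc-nonwrapping : ∀ {a b x} → a ℚ.≤ b → (x ∈Arc arcFromTo a b) ⇔ (a ℚ.≤ x × x ℚ.≤ b)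
∈Arc-nonwrapping a≤b = mk⇔
  (λ { (inj₁ (_ , a≤x≤b)) → a≤x≤b ; (inj₂ (b<a , _)) → contradiction a≤b (ℚ<⇒≱ b<a) })
  (λ a≤x≤b → inj₁ (a≤b , a≤x≤b))

∈Arc-wrapping : ∀ {a b x} → b ℚ.< a → (x ∈Arc arcFromTo a b) ⇔ (a ℚ.≤ x ⊎ x ℚ.≤ b)
∈Arc-wrapping b<a = mk⇔
  (λ { (inj₁ (a≤b , _)) → contradiction a≤b (ℚ<⇒≱ b<a) ; (inj₂ (_ , a≤x⊎x≤b)) → a≤x⊎x≤b })
  (λ a≤x⊎x≤b → inj₂ (b<a , a≤x⊎x≤b))

injective⇒surjective : ∀ {m} (f : Fin m → Fin m) → Injective _≡_ _≡_ f → Surjective _≡_ _≡_ f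
injective⇒surjective {suc m} f f-injective i with any? (λ v → f v Fin.≟ i)
... | yes (v , fv≡i) = v , λ { refl → fv≡i }
... | no misses = contradiction (injective⇒≤ g-injective) 1+n≰n
  where
  i≢f : ∀ v → i ≢ f v
  i≢f v i≡fv = misses (v , sym i≡fv)
  g : Fin (suc m) → Fin m
  g v = punchOut (i≢f v)
  g-injective : Injective _≡_ _≡_ g
  g-injective {u} {v} = f-injective ∘ punchOut-injective (i≢f u) (i≢f v)

module SortBy {a ℓ₁ ℓ₂} (O : StrictTotalOrder a ℓ₁ ℓ₂) {n : ℕ}
              (key : Fin n → StrictTotalOrder.Carrier O) where

  open StrictTotalOrder O using () renaming (_<_ to _⊏_)

  -- Sort lexicographically by (key, index), so that no two vertices tie.
  private
    module Lex = StrictTotalOrder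
      (On.strictTotalOrder (×-strictTotalOrder O (FinP.<-strictTotalOrder n)) (λ u → key u , u))

  below-test : Fin n → Fin n → Bool
  below-test v u = ⌊ u Lex.<? v ⌋

  below : Fin n → Subset n
  below v = tabulate (below-test v)

  ∈below⇔ : ∀ {u v} → (u ∈ below v) ⇔ (u Lex.< v)
  ∈below⇔ {u} {v} = mk⇔
    (λ u∈ → toWitness {a? = u Lex.<? v} (from T-≡ (trans (sym (lookup∘tabulate (below-test v) u)) ([]=⇒lookup u∈))))
    (λ u<v → lookup⇒[]= u (below v) (trans (lookup∘tabulate (below-test v) u) (to T-≡ (fromWitness u<v))))

  ∉below-self : ∀ v → v ∉ below v
  ∉below-self v = Lex.irrefl Lex.Eq.refl ∘ to ∈below⇔

  rank : Fin n → ℕ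
  rank v = ∣ below v ∣

  rank<n : ∀ v → rank v < n
  rank<n v = subst (rank v <_) (∣⊤∣≡n n) (p⊂q⇒∣p∣<∣q∣ ((λ _ → ∈⊤) , v , ∈⊤ , ∉below-self v))

  rank-mono : ∀ {u v} → u Lex.< v → rank u < rank v
  rank-mono {u} u<v = p⊂q⇒∣p∣<∣q∣
    ( (λ w∈ → from ∈below⇔ (Lex.trans (to ∈below⇔ w∈) u<v))
    , u , from ∈below⇔ u<v , ∉below-self u)

  rankFin : Fin n → Fin n
  rankFin v = fromℕ< (rank<n v)

  toℕ-rankFin : ∀ v → toℕ (rankFin v) ≡ rank v
  toℕ-rankFin v = toℕ-fromℕ< (rank<n v)

  rank-≡ : ∀ {u v} → rankFin u ≡ rankFin v → rank u ≡ rank v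
  rank-≡ {u} {v} eq = trans (sym (toℕ-rankFin u)) (trans (cong toℕ eq) (toℕ-rankFin v))

  rankFin-injective : Injective _≡_ _≡_ rankFin
  rankFin-injective {u} {v} eq with Lex.compare u v
  ... | tri< u<v _ _       = contradiction (rank-≡ eq) (<⇒≢ (rank-mono u<v))
  ... | tri≈ _ (_ , u≡v) _ = u≡v
  ... | tri> _ _ v<u       = contradiction (sym (rank-≡ eq)) (<⇒≢ (rank-mono v<u))

  σ : Permutation′ n
  σ = flip (⤖⇒↔ (mk⤖ (rankFin-injective , injective⇒surjective rankFin rankFin-injective)))

  sorted : ∀ {i j} → toℕ i ≤ toℕ j → ¬ key (σ ⟨$⟩ʳ j) ⊏ key (σ ⟨$⟩ʳ i)
  sorted {i} {j} i≤j key-j<key-i = <⇒≱ (subst₂ _<_ (position j) (position i) (rank-mono (inj₁ key-j<key-i))) i≤j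
    where
    position : ∀ k → rank (σ ⟨$⟩ʳ k) ≡ toℕ k
    position k = trans (sym (toℕ-rankFin (σ ⟨$⟩ʳ k))) (cong toℕ (inverseˡ σ))

downClosed⇒initialSegment : ∀ {p} {P : Fin n → Set p} → Decidable P →
  (∀ {i j} → toℕ i ≤ toℕ j → P j → P i) → ∃ λ m → m ≤ n × ∀ j → P j ⇔ (toℕ j < m)
downClosed⇒initialSegment {zero} _ _ = 0 , z≤n , λ ()
downClosed⇒initialSegment {suc n} P? down with P? Fin.zero
... | no ¬P0 = 0 , z≤n , λ j → mk⇔ (λ Pj → contradiction (down z≤n Pj) ¬P0) λ ()
... | yes P0 with downClosed⇒initialSegment (P? ∘ Fin.suc) (λ i≤j → down (s≤s i≤j))
...   | m , m≤n , P∘suc⇔ = suc m , s≤s m≤n , λ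
  { Fin.zero    → mk⇔ (λ _ → s≤s z≤n) (λ _ → P0)
  ; (Fin.suc j) → mk⇔ (s≤s ∘ to (P∘suc⇔ j)) (from (P∘suc⇔ j) ∘ s≤s⁻¹) }

initialSegment-⊆ : ∀ {p q} {P : Fin n → Set p} {Q : Fin n → Set q} {l m} → l ≤ n →
  (∀ {j} → P j → Q j) → (∀ j → P j ⇔ (toℕ j < l)) → (∀ j → Q j ⇔ (toℕ j < m)) → l ≤ m
initialSegment-⊆ {l = l} l≤n P⊆Q P⇔ Q⇔ = ≮⇒≥ λ m<l →
  let m<n = <-≤-trans m<l l≤n
      j   = fromℕ< m<n
  in <-irrefl (toℕ-fromℕ< m<n) (to (Q⇔ j) (P⊆Q (from (P⇔ j) (subst (_< l) (sym (toℕ-fromℕ< m<n)) m<l))))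

module _ (q : Fin n → ℚ) (q-mono : ∀ {i j} → toℕ i ≤ toℕ j → q i ℚ.≤ q j) where

  private
    below-segment : ∀ c → ∃ λ m → m ≤ n × ∀ j → (q j ℚ.< c) ⇔ (toℕ j < m)
    below-segment c = downClosed⇒initialSegment (λ j → q j ℚP.<? c) (λ i≤j → ℚP.≤-<-trans (q-mono i≤j))

    atMost-segment : ∀ c → ∃ λ m → m ≤ n × ∀ j → (q j ℚ.≤ c) ⇔ (toℕ j < m)
    atMost-segment c = downClosed⇒initialSegment (λ j → q j ℚP.≤? c) (λ i≤j → ℚP.≤-trans (q-mono i≤j))

    above-segment : ∀ {c m} → (∀ j → (q j ℚ.< c) ⇔ (toℕ j < m)) → ∀ j → (c ℚ.≤ q j) ⇔ (m ≤ toℕ j)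
    above-segment below j = ⇔-sym ≥⇔≮ ⇔-∘ (¬-cong-⇔ (below j) ⇔-∘ ℚ≥⇔≮)

  monotone⇒caught-circularInterval : ∀ A → CircularInterval (λ j → q j ∈Arc A)
  monotone⇒caught-circularInterval (arcFromTo a b) with a ℚP.≤? b
  ... | yes a≤b =
    let lo , lo≤n , below-a  = below-segment a
        hi , hi≤n , atMost-b = atMost-segment b
        lo≤hi = initialSegment-⊆ lo≤n (λ qj<a → ℚP.<⇒≤ (ℚP.<-≤-trans qj<a a≤b)) below-a atMost-b
    in interval lo≤hi hi≤n (λ j → (above-segment below-a j ×-⇔ atMost-b j) ⇔-∘ ∈Arc-nonwrapping a≤b)
  ... | no a≰b =
    let b<a = ℚP.≰⇒> a≰b
        lo , lo≤n , atMost-b = atMost-segment b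
        hi , hi≤n , below-a  = below-segment a
        lo≤hi = initialSegment-⊆ lo≤n (λ qj≤b → ℚP.≤-<-trans qj≤b b<a) atMost-b below-a
    in coInterval lo≤hi hi≤n (λ j →
         ⇔-sym ¬Interval⇔ ⇔-∘ ((above-segment below-a j ⊎-⇔ atMost-b j) ⇔-∘ ∈Arc-wrapping b<a))

double≤odd⇔ : ∀ {x j} → (x + x ≤ suc (j + j)) ⇔ (x ≤ j)
double≤odd⇔ {x} {j} = mk⇔
  (λ le → ≮⇒≥ (λ j<x → <⇒≱ (subst (_≤ x + x) (cong suc (+-suc j j)) (+-mono-<-≤ j<x j<x)) le))
  (λ x≤j → m≤n⇒m≤1+n (+-mono-≤ x≤j x≤j))

odd≤double⇔ : ∀ {j y} → (suc (j + j) ≤ y + y) ⇔ (j < y)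
odd≤double⇔ {j} {y} = mk⇔
  (λ le → ≰⇒> (λ y≤j → <⇒≱ (s≤s (+-mono-≤ y≤j y≤j)) le))
  (λ j<y → +-mono-≤ j<y (<⇒≤ j<y))

-- grid m = m/(2n+1), since mkℚᵘ m d denotes m/(d+1).
module Grid (n : ℕ) where

  grid : ℕ → ℚ
  grid m = fromℚᵘ (mkℚᵘ (+ m) (n + n))

  toℚᵘ-grid : ∀ m → ℚ.toℚᵘ (grid m) ℚᵘ.≃ mkℚᵘ (+ m) (n + n)
  toℚᵘ-grid m = ℚP.toℚᵘ-fromℚᵘ (mkℚᵘ (+ m) (n + n))

  grid-mono-< : ∀ {x y} → x < y → grid x ℚ.< grid y
  grid-mono-< {x} {y} x<y = ℚP.toℚᵘ-cancel-<
    (ℚᵘP.<-respˡ-≃ (ℚᵘP.≃-sym (toℚᵘ-grid x)) (ℚᵘP.<-respʳ-≃ (ℚᵘP.≃-sym (toℚᵘ-grid y))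
      (*<* (ℤP.*-monoʳ-<-pos (+ suc (n + n)) (+<+ x<y)))))

  grid-≤⇔ : ∀ {x y} → (grid x ℚ.≤ grid y) ⇔ (x ≤ y)
  grid-≤⇔ {x} {y} = mk⇔
    (λ le → ≮⇒≥ (λ y<x → ℚ<⇒≱ (grid-mono-< y<x) le))
    grid-mono-≤
    where
    grid-mono-≤ : x ≤ y → grid x ℚ.≤ grid y
    grid-mono-≤ x≤y with m≤n⇒m<n∨m≡n x≤y
    ... | inj₁ x<y  = ℚP.<⇒≤ (grid-mono-< x<y)
    ... | inj₂ refl = ℚP.≤-refl

  grid-onCircle : ∀ {m} → m ≤ n + n → OnCircle (grid m)
  grid-onCircle {m} m≤2n =
    ℚP.toℚᵘ-cancel-≤ (ℚᵘP.≤-respʳ-≃ (ℚᵘP.≃-sym (toℚᵘ-grid m))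
      (*≤* (ℤP.*-monoʳ-≤-nonNeg (+ 1) {+ 0} {+ m} (+≤+ z≤n)))) ,
    ℚP.toℚᵘ-cancel-< (ℚᵘP.<-respˡ-≃ (ℚᵘP.≃-sym (toℚᵘ-grid m))
      (*<* (subst₂ ℤ._<_ (sym (ℤP.*-identityʳ (+ m))) (sym (ℤP.*-identityˡ (+ suc (n + n))))
        (+<+ (s≤s m≤2n)))))

  point : ℕ → ℚ
  point j = grid (suc (j + j))

  boundary : ℕ → ℚ
  boundary x = grid (x + x)

  boundary≤point⇔ : ∀ {x j} → (boundary x ℚ.≤ point j) ⇔ (x ≤ j)
  boundary≤point⇔ = double≤odd⇔ ⇔-∘ grid-≤⇔

  point≤boundary⇔ : ∀ {j y} → (point j ℚ.≤ boundary y) ⇔ (j < y)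
  point≤boundary⇔ = odd≤double⇔ ⇔-∘ grid-≤⇔

  point-onCircle : ∀ {j} → j < n → OnCircle (point j)
  point-onCircle j<n = grid-onCircle (+-mono-≤ j<n (<⇒≤ j<n))

  boundary-onCircle : ∀ {x} → x ≤ n → OnCircle (boundary x)
  boundary-onCircle x≤n = grid-onCircle (+-mono-≤ x≤n x≤n)

  record CatchingArc {p} (X : Fin n → Set p) : Set p where
    field
      catcher        : Arc
      start-onCircle : OnCircle (start catcher)
      end-onCircle   : OnCircle (end catcher)
      catches        : ∀ j → X j ⇔ (point (toℕ j) ∈Arc catcher)

  circularInterval⇒catchingArc : ∀ {p} {X : Fin n → Set p} → CircularInterval X → CatchingArc X
  circularInterval⇒catchingArc (interval {lo} {hi} lo≤hi hi≤n h) = record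
    { catcher        = arcFromTo (boundary lo) (boundary hi)
    ; start-onCircle = boundary-onCircle (≤-trans lo≤hi hi≤n)
    ; end-onCircle   = boundary-onCircle hi≤n
    ; catches        = λ j → ⇔-sym (∈Arc-nonwrapping (from grid-≤⇔ (+-mono-≤ lo≤hi lo≤hi)))
                              ⇔-∘ (⇔-sym (boundary≤point⇔ ×-⇔ point≤boundary⇔) ⇔-∘ h j)
    }
  circularInterval⇒catchingArc (coInterval {lo} {hi} lo≤hi hi≤n h) with lo <? hi
  ... | yes lo<hi = record
    { catcher        = arcFromTo (boundary hi) (boundary lo)
    ; start-onCircle = boundary-onCircle hi≤n
    ; end-onCircle   = boundary-onCircle (≤-trans lo≤hi hi≤n)
    ; catches        = λ j → ⇔-sym (∈Arc-wrapping (grid-mono-< (+-mono-< lo<hi lo<hi)))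
                              ⇔-∘ (⇔-sym (boundary≤point⇔ ⊎-⇔ point≤boundary⇔) ⇔-∘ (¬Interval⇔ ⇔-∘ h j))
    }
  ... | no lo≮hi = record
    { catcher        = arcFromTo (boundary 0) (boundary n)
    ; start-onCircle = boundary-onCircle z≤n
    ; end-onCircle   = boundary-onCircle ≤-refl
    ; catches        = λ j → mk⇔
        (λ _ → inj₁ (from (grid-≤⇔ {0} {n + n}) z≤n , from (boundary≤point⇔ {0} {toℕ j}) z≤n ,
                     from (point≤boundary⇔ {toℕ j} {n}) (toℕ<n j)))
        (λ _ → from (h j) (λ (lo≤j , j<hi) → lo≮hi (≤-<-trans lo≤j j<hi)))
    }

augAdj-diag : ∀ (G : SimpleDigraph n) v → augAdj G v v ≡ true
augAdj-diag G v with v Fin.≟ v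
... | yes _   = refl
... | no v≢v = contradiction refl v≢v

augAdj-offDiag : ∀ (G : SimpleDigraph n) {u v} → u ≢ v → augAdj G u v ≡ arc G u v
augAdj-offDiag G {u} {v} u≢v with u Fin.≟ v
... | yes u≡v = contradiction u≡v u≢v
... | no _    = refl

catch⇔augAdj-catch : ∀ (G : SimpleDigraph n) (I : Fin n → Arc) (p : Fin n → ℚ) →
  ((∀ v → p v ∈Arc I v) × (∀ u v → u ≢ v → (arc G u v ≡ true) ⇔ (p v ∈Arc I u)))
  ⇔ (∀ u v → (augAdj G u v ≡ true) ⇔ (p v ∈Arc I u))
catch⇔augAdj-catch G I p = mk⇔ augCatch
  (λ aug → (λ v → to (aug v v) (augAdj-diag G v)) ,
           (λ u v u≢v → subst (λ b → (b ≡ true) ⇔ _) (augAdj-offDiag G u≢v) (aug u v)))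
  where
  augCatch : (∀ v → p v ∈Arc I v) × (∀ u v → u ≢ v → (arc G u v ≡ true) ⇔ (p v ∈Arc I u)) →
             ∀ u v → (augAdj G u v ≡ true) ⇔ (p v ∈Arc I u)
  augCatch (self , catch) u v with u Fin.≟ v
  ... | yes refl = mk⇔ (λ _ → self u) (λ _ → refl)
  ... | no u≢v   = catch u v u≢v

catchDigraph⇒circularOnesOrdering : ∀ (G : SimpleDigraph n) →
  IsCircularArcCatchDigraph G → ∃[ σ ] HasCircularOnesForOrdering G σ
catchDigraph⇒circularOnesOrdering G (I , p , _ , catch) = σ , λ i →
  circularInterval⇒rowCircularOnes i
    (circularInterval-resp (λ j → augAdj-catch (σ ⟨$⟩ʳ i) (σ ⟨$⟩ʳ j))
      (monotone⇒caught-circularInterval (p ∘ (σ ⟨$⟩ʳ_)) (ℚP.≮⇒≥ ∘ sorted) (I (σ ⟨$⟩ʳ i))))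
  where
  open SortBy ℚP.<-strictTotalOrder p using (σ; sorted)
  augAdj-catch : ∀ u v → (augAdj G u v ≡ true) ⇔ (p v ∈Arc I u)
  augAdj-catch = to (catch⇔augAdj-catch G I p) catch

circularOnesOrdering⇒catchDigraph : ∀ (G : SimpleDigraph n) →
  ∃[ σ ] HasCircularOnesForOrdering G σ → IsCircularArcCatchDigraph G
circularOnesOrdering⇒catchDigraph {n} G (σ , rows) =
  I , p , onCircle , from (catch⇔augAdj-catch G I p) augAdj-catch
  where
  open Grid n
  rowArc : ∀ i → CatchingArc (λ j → augAdj G (σ ⟨$⟩ʳ i) (σ ⟨$⟩ʳ j) ≡ true)
  rowArc i = circularInterval⇒catchingArc (rowCircularOnes⇒circularInterval (rows i))
  open module RowArc i = CatchingArc (rowArc i)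
  I : Fin n → Arc
  I u = catcher (σ ⟨$⟩ˡ u)
  p : Fin n → ℚ
  p v = point (toℕ (σ ⟨$⟩ˡ v))
  onCircle : ∀ v → OnCircle (start (I v)) × OnCircle (end (I v)) × OnCircle (p v)
  onCircle v = start-onCircle (σ ⟨$⟩ˡ v) , end-onCircle (σ ⟨$⟩ˡ v) , point-onCircle (toℕ<n (σ ⟨$⟩ˡ v))
  augAdj-catch : ∀ u v → (augAdj G u v ≡ true) ⇔ (p v ∈Arc I u)
  augAdj-catch u v = subst₂ (λ u′ v′ → (augAdj G u′ v′ ≡ true) ⇔ (p v ∈Arc I u))
    (inverseʳ σ) (inverseʳ σ) (catches (σ ⟨$⟩ˡ u) (σ ⟨$⟩ˡ v))

mainTheorem1 : ∀ {n : ℕ} (G : SimpleDigraph n) →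
    IsCircularArcCatchDigraph G ⇔ (∃[ σ ] HasCircularOnesForOrdering {n} G σ)
mainTheorem1 G = mk⇔ (catchDigraph⇒circularOnesOrdering G) (circularOnesOrdering⇒catchDigraph G)
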